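{- Let $n,k$ be integers with $n\geq k+1\geq 2$. Then $E_{n}(as_k)=\frac{4(n-k)+5}{6}$ holds if and only if $E_{n}(zs_k)=\frac{2(n-k)+4}{3}$ holds.
   Context: $\mathfrak{S}_n$ is the set of permutations of $\{1,\dots,n\}$, written $w=w_1w_2\cdots w_n$. A subsequence $w_{i_1}\cdots w_{i_s}$ ($i_1<\dots<i_s$) is alternating if $w_{i_1}>w_{i_2}<w_{i_3}>\cdots$, reverse alternating if $w_{i_1}<w_{i_2}>w_{i_3}<\cdots$, and zigzagging if it is alternating or reverse alternating. It is $k$-alternating (resp. $k$-zigzagging) if it is alternating (resp. zigzagging) and $|w_{i_j}-w_{i_{j+1}}|\ge k$ for all $1\le j<s$. $as_k(w)$ (resp. $zs_k(w)$) is the maximal length of a $k$-alternating (resp. $k$-zigzagging) subsequence of $w$, and $E_n(as_k)=\frac1{n!}\sum_{w\in\mathfrak S_n}as_k(w)$, $E_n(zs_k)=\frac1{n!}\sum_{w\in\mathfrak S_n}zs_k(w)$. -}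

module Defs where

open import Data.Nat using (ℕ; zero; suc; _+_; _*_; _∸_; _⊔_; _<ᵇ_; _≤ᵇ_; _!)
open import Data.Nat.Properties using (_!≢0)
open import Data.Bool using (Bool; true; false; _∧_; _∨_; if_then_else_)
open import Data.List using (List; []; _∷_; map; concatMap; length; foldr; filter; upTo)
open import Data.Nat.ListAction using (sum)
open import Data.Integer using (+_)
open import Data.Rational using (ℚ; _/_)

insertions : ℕ → List ℕ → List (List ℕ)
insertions x [] = (x ∷ []) ∷ []
insertions x (y ∷ ys) = (x ∷ y ∷ ys) ∷ map (y ∷_) (insertions x ys)

permutations : List ℕ → List (List ℕ)
permutations [] = [] ∷ []
permutations (x ∷ xs) = concatMap (insertions x) (permutations xs)

oneTo : ℕ → List ℕ
oneTo n = map suc (upTo n)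

S : ℕ → List (List ℕ)
S n = permutations (oneTo n)

subsequences : List ℕ → List (List ℕ)
subsequences [] = [] ∷ []
subsequences (x ∷ xs) = let r = subsequences xs in map (x ∷_) r Data.List.++ r

farApart : ℕ → ℕ → ℕ → Bool
farApart k a b = (k + b ≤ᵇ a) ∨ (k + a ≤ᵇ b)

mutual
  kAlt : ℕ → List ℕ → Bool
  kAlt k [] = true
  kAlt k (x ∷ []) = true
  kAlt k (x ∷ y ∷ r) = (y <ᵇ x) ∧ farApart k x y ∧ kRevAlt k (y ∷ r)

  kRevAlt : ℕ → List ℕ → Bool
  kRevAlt k [] = true
  kRevAlt k (x ∷ []) = true
  kRevAlt k (x ∷ y ∷ r) = (x <ᵇ y) ∧ farApart k x y ∧ kAlt k (y ∷ r)

kZig : ℕ → List ℕ → Bool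
kZig k s = kAlt k s ∨ kRevAlt k s

maximum : List ℕ → ℕ
maximum = foldr _⊔_ 0

maxLen : (List ℕ → Bool) → List ℕ → ℕ
maxLen p w = maximum (map (λ s → if p s then length s else 0) (subsequences w))

as : ℕ → List ℕ → ℕ
as k = maxLen (kAlt k)

zs : ℕ → List ℕ → ℕ
zs k = maxLen (kZig k)

E : ℕ → (List ℕ → ℕ) → ℚ
E n f = _/_ (+ sum (map f (S n))) (n !) {{n !≢0}}

-- Longest k-alternating and k-reverse-alternating subsequences can be chosen greedily.
-- While the entries read so far span less than k, no k-step is possible and each search
-- only remembers its best starting point: the largest entry read for an alternating, the
-- smallest for a reverse alternating subsequence. The first entry z lying k below that
-- maximum or k above that minimum gives one of them a step, while z becomes the better
-- starting point of the other; from then on they stay exactly one step apart. Hence as_k(w)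
-- and the reverse alternating length ras_k(w) differ by one whenever w has two entries k
-- apart, so 2 zs_k(w) = as_k(w) + ras_k(w) + 1 for w ∈ 𝔖ₙ, n ≥ k + 1. The complement
-- w ↦ (n + 1) − w permutes 𝔖ₙ and exchanges the two kinds of subsequences, so
-- Σ ras_k = Σ as_k and E_n(zs_k) = E_n(as_k) + 1/2; the equivalence is then arithmetic.
module Submission where

open import Defs
open import Data.Bool using (Bool; true; false; not; T; if_then_else_; _∧_; _∨_)
open import Data.Bool.Properties using (T-∧; T-∨; T-≡; ∨-comm; not-involutive)
open import Data.Empty using (⊥-elim)
open import Data.List using (List; []; _∷_; map; length; foldl; concatMap; upTo; applyUpTo; _++_)
open import Data.List.Properties
  using (length-map; length-++; length-upTo; map-cong-local; map-∘; map-upTo; applyUpTo-∷ʳ;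
         concatMap-++; concatMap-map; map-concatMap; concatMap-cong)
open import Data.List.Membership.Propositional using (_∈_)
open import Data.List.Membership.Propositional.Properties using (∈-map⁺; ∈-map⁻; ∈-++⁻; ∈-++⁺ˡ; ∈-++⁺ʳ; ∈-concat⁻′; ∈-upTo⁺; ∈-upTo⁻)
open import Data.List.Relation.Unary.All as All using (All; []; _∷_)
import Data.List.Relation.Unary.All.Properties as All
open import Data.List.Relation.Binary.Permutation.Propositional as ↭
  using (_↭_; ↭-refl; ↭-reflexive; ↭-sym; ↭-prep; ↭-swap; ↭-trans; module PermutationReasoning)
open import Data.List.Relation.Binary.Permutation.Propositional.Properties
  using (++⁺; ++⁺ˡ; shifts; ↭-length; ∷↭∷ʳ; ∈-resp-↭) renaming (map⁺ to ↭-map⁺)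
open import Data.List.Relation.Unary.Any using (here; there)
open import Data.List.Relation.Binary.Sublist.Propositional using (_⊆_; []; _∷_; _∷ʳ_; ⊆-refl; ⊆-trans; minimum)
open import Data.List.Relation.Binary.Sublist.Propositional.Properties using (∷ˡ⁻; All-resp-⊆) renaming (map⁺ to ⊆-map⁺)
open import Data.Nat using (ℕ; zero; suc; _+_; _*_; _∸_; _≤_; _<_; _⊔_; _⊓_; _≤ᵇ_; _!; z≤n; s≤s; s≤s⁻¹; z<s; NonZero)
open import Data.Nat.Properties
open import Data.Nat.Tactic.RingSolver using (solve-∀)
open import Data.Integer using (+_)
import Data.Integer.Properties as ℤ
open import Data.Rational using (_/_)
open import Data.Rational.Unnormalised using (mkℚᵘ; *≡*)
open import Data.Rational.Properties using (fromℚᵘ-injective; fromℚᵘ-cong)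
open import Data.Nat.ListAction using (sum)
open import Data.Nat.ListAction.Properties using (sum-↭)
open import Algebra.Properties.CommutativeSemigroup +-commutativeSemigroup using (interchange; x∙yz≈y∙xz)
open import Data.Product using (_×_; _,_; proj₁; proj₂)
open import Data.Sum using (_⊎_; inj₁; inj₂; [_,_]) renaming (swap to ⊎-swap)
open import Function.Base using (_∘_)
open import Function.Bundles using (_⇔_; mk⇔; Equivalence)
open import Function.Properties.Equivalence using (⇔-setoid)
open import Level using (0ℓ)
open import Relation.Binary.PropositionalEquality using (_≡_; refl; sym; trans; cong; cong₂; subst; subst₂; module ≡-Reasoning)
open import Relation.Binary.Reasoning.Setoid as SetoidReasoning using ()
open import Relation.Nullary using (¬_; yes; no)
open import Relation.Nullary.Decidable using (does-⇔)

private
  variable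
    A B C : Set

maximum-lub : ∀ {l N} → All (_≤ N) l → maximum l ≤ N
maximum-lub [] = z≤n
maximum-lub (a≤N ∷ l≤N) = ⊔-lub a≤N (maximum-lub l≤N)

∈⇒≤maximum : ∀ {l a} → a ∈ l → a ≤ maximum l
∈⇒≤maximum {b ∷ l} (here refl) = m≤m⊔n b _
∈⇒≤maximum {b ∷ l} (there a∈l) = ≤-trans (∈⇒≤maximum a∈l) (m≤n⊔m b _)

foldl-⊓-lower : ∀ m xs {a} → a ∈ m ∷ xs → foldl _⊓_ m xs ≤ a
foldl-⊓-lower m [] (here refl) = ≤-refl
foldl-⊓-lower m (x ∷ xs) (here refl) = ≤-trans (foldl-⊓-lower (m ⊓ x) xs (here refl)) (m⊓n≤m m x)
foldl-⊓-lower m (x ∷ xs) (there (here refl)) = ≤-trans (foldl-⊓-lower (m ⊓ x) xs (here refl)) (m⊓n≤n m x)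
foldl-⊓-lower m (x ∷ xs) (there (there a∈xs)) = foldl-⊓-lower (m ⊓ x) xs (there a∈xs)

foldl-⊔-upper : ∀ m xs {a} → a ∈ m ∷ xs → a ≤ foldl _⊔_ m xs
foldl-⊔-upper m [] (here refl) = ≤-refl
foldl-⊔-upper m (x ∷ xs) (here refl) = ≤-trans (m≤m⊔n m x) (foldl-⊔-upper (m ⊔ x) xs (here refl))
foldl-⊔-upper m (x ∷ xs) (there (here refl)) = ≤-trans (m≤n⊔m m x) (foldl-⊔-upper (m ⊔ x) xs (here refl))
foldl-⊔-upper m (x ∷ xs) (there (there a∈xs)) = foldl-⊔-upper (m ⊔ x) xs (there a∈xs)

sum-map-+ : ∀ (f g : A → ℕ) xs → sum (map (λ x → f x + g x) xs) ≡ sum (map f xs) + sum (map g xs)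
sum-map-+ f g [] = refl
sum-map-+ f g (x ∷ xs) = trans (cong (λ t → f x + g x + t) (sum-map-+ f g xs)) (interchange (f x) (g x) _ _)

sum-map-suc : ∀ (f : A → ℕ) xs → sum (map (suc ∘ f) xs) ≡ length xs + sum (map f xs)
sum-map-suc f [] = refl
sum-map-suc f (x ∷ xs) = cong suc (trans (cong (λ t → f x + t) (sum-map-suc f xs)) (x∙yz≈y∙xz (f x) (length xs) _))

Adjacent : ℕ → ℕ → Set
Adjacent a b = a ≡ suc b ⊎ b ≡ suc a

Adjacent⇒⊔+⊔ : ∀ {a b} → Adjacent a b → (a ⊔ b) + (a ⊔ b) ≡ suc (a + b)
Adjacent⇒⊔+⊔ {b = b} (inj₁ refl) rewrite m≥n⇒m⊔n≡m (n≤1+n b) = cong suc (+-suc b b)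
Adjacent⇒⊔+⊔ {a} (inj₂ refl) rewrite m≤n⇒m⊔n≡n (n≤1+n a) = refl

∸-flip-≤ : ∀ N j {x y} → y ≤ N → j + x ≤ y → j + (N ∸ y) ≤ N ∸ x
∸-flip-≤ N j {x} {y} y≤N j+x≤y = begin
  j + (N ∸ y)       ≡⟨ +-∸-assoc j y≤N ⟨
  (j + N) ∸ y       ≤⟨ ∸-monoʳ-≤ (j + N) j+x≤y ⟩
  (j + N) ∸ (j + x) ≡⟨ [m+n]∸[m+o]≡n∸o j N x ⟩
  N ∸ x             ∎
  where open ≤-Reasoning

complement-≤ᵇ : ∀ N j {x y} → x ≤ N → y ≤ N → (j + (N ∸ y) ≤ᵇ N ∸ x) ≡ (j + x ≤ᵇ y)
complement-≤ᵇ N j {x} {y} x≤N y≤N = does-⇔ (mk⇔ unflip (∸-flip-≤ N j y≤N)) (_ ≤? _) (_ ≤? _)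
  where
  unflip : j + (N ∸ y) ≤ N ∸ x → j + x ≤ y
  unflip h = subst₂ (λ a b → j + a ≤ b) (m∸[m∸n]≡n x≤N) (m∸[m∸n]≡n y≤N) (∸-flip-≤ N j (m∸n≤m N x) h)

complement-involutive : ∀ N {w} → All (_≤ N) w → map (N ∸_) (map (N ∸_) w) ≡ w
complement-involutive N [] = refl
complement-involutive N (x≤N ∷ w≤N) = cong₂ _∷_ (m∸[m∸n]≡n x≤N) (complement-involutive N w≤N)

concatMap-concatMap : ∀ (f : B → List C) (g : A → List B) xs →
                      concatMap f (concatMap g xs) ≡ concatMap (concatMap f ∘ g) xs
concatMap-concatMap f g [] = refl
concatMap-concatMap f g (x ∷ xs) =
  trans (concatMap-++ f (g x) (concatMap g xs)) (cong (concatMap f (g x) ++_) (concatMap-concatMap f g xs))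

concatMap-∷ : ∀ (f : A → B) (g : A → List B) xs → concatMap (λ x → f x ∷ g x) xs ↭ map f xs ++ concatMap g xs
concatMap-∷ f g [] = ↭-refl
concatMap-∷ f g (x ∷ xs) = ↭-prep (f x) (begin
  g x ++ concatMap (λ x → f x ∷ g x) xs ↭⟨ ++⁺ˡ (g x) (concatMap-∷ f g xs) ⟩
  g x ++ map f xs ++ concatMap g xs     ↭⟨ shifts (g x) (map f xs) ⟩
  map f xs ++ g x ++ concatMap g xs     ∎)
  where open PermutationReasoning

concatMap⁺ : ∀ (f : A → List B) {xs ys} → xs ↭ ys → concatMap f xs ↭ concatMap f ys
concatMap⁺ f ↭.refl = ↭-refl
concatMap⁺ f (↭.prep x p) = ++⁺ˡ (f x) (concatMap⁺ f p)
concatMap⁺ f (↭.swap x y p) = ↭-trans (shifts (f x) (f y)) (++⁺ˡ (f y) (++⁺ˡ (f x) (concatMap⁺ f p)))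
concatMap⁺ f (↭.trans p q) = ↭-trans (concatMap⁺ f p) (concatMap⁺ f q)

concatMap-↭-pointwise : ∀ {f g : A → List B} → (∀ x → f x ↭ g x) → ∀ xs → concatMap f xs ↭ concatMap g xs
concatMap-↭-pointwise f↭g [] = ↭-refl
concatMap-↭-pointwise f↭g (x ∷ xs) = ++⁺ (f↭g x) (concatMap-↭-pointwise f↭g xs)

∈-insertions⁻ : ∀ x ys {r} → r ∈ insertions x ys → r ↭ x ∷ ys
∈-insertions⁻ x [] (here refl) = ↭-refl
∈-insertions⁻ x (y ∷ ys) (here refl) = ↭-refl
∈-insertions⁻ x (y ∷ ys) (there r∈) with ∈-map⁻ (y ∷_) r∈
... | r′ , r′∈ , refl = ↭-trans (↭-prep y (∈-insertions⁻ x ys r′∈)) (↭-swap y x ↭-refl)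

∈-permutations⁻ : ∀ xs {w} → w ∈ permutations xs → w ↭ xs
∈-permutations⁻ [] (here refl) = ↭-refl
∈-permutations⁻ (x ∷ xs) w∈ with ∈-concat⁻′ (map (insertions x) (permutations xs)) w∈
... | ws , w∈ws , ws∈ with ∈-map⁻ (insertions x) ws∈
...   | p , p∈ , refl = ↭-trans (∈-insertions⁻ x p w∈ws) (↭-prep x (∈-permutations⁻ xs p∈))

length-insertions : ∀ x ys → length (insertions x ys) ≡ suc (length ys)
length-insertions x [] = refl
length-insertions x (y ∷ ys) = cong suc (trans (length-map (y ∷_) (insertions x ys)) (length-insertions x ys))

length-concatMap-insertions : ∀ x L ps → All (λ p → length p ≡ L) ps →
                              length (concatMap (insertions x) ps) ≡ length ps * suc L
length-concatMap-insertions x L [] [] = refl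
length-concatMap-insertions x L (p ∷ ps) (p≡L ∷ ps≡L) = trans (length-++ (insertions x p))
  (cong₂ _+_ (trans (length-insertions x p) (cong suc p≡L)) (length-concatMap-insertions x L ps ps≡L))

length-permutations : ∀ xs → length (permutations xs) ≡ length xs !
length-permutations [] = refl
length-permutations (x ∷ xs) = begin
  length (concatMap (insertions x) (permutations xs)) ≡⟨ length-concatMap-insertions x (length xs) (permutations xs)
                                                           (All.tabulate (↭-length ∘ ∈-permutations⁻ xs)) ⟩
  length (permutations xs) * suc (length xs)          ≡⟨ cong (_* suc (length xs)) (length-permutations xs) ⟩
  length xs ! * suc (length xs)                       ≡⟨ *-comm (length xs !) (suc (length xs)) ⟩
  suc (length xs) !                                   ∎
  where open ≡-Reasoning

map-insertions : ∀ (f : ℕ → ℕ) x ys → map (map f) (insertions x ys) ≡ insertions (f x) (map f ys)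
map-insertions f x [] = refl
map-insertions f x (y ∷ ys) = cong ((f x ∷ f y ∷ map f ys) ∷_) (begin
  map (map f) (map (y ∷_) (insertions x ys)) ≡⟨ map-∘ (insertions x ys) ⟨
  map (λ r → f y ∷ map f r) (insertions x ys) ≡⟨ map-∘ (insertions x ys) ⟩
  map (f y ∷_) (map (map f) (insertions x ys)) ≡⟨ cong (map (f y ∷_)) (map-insertions f x ys) ⟩
  map (f y ∷_) (insertions (f x) (map f ys))   ∎)
  where open ≡-Reasoning

map-permutations : ∀ (f : ℕ → ℕ) xs → map (map f) (permutations xs) ≡ permutations (map f xs)
map-permutations f [] = refl
map-permutations f (x ∷ xs) = begin
  map (map f) (concatMap (insertions x) (permutations xs))     ≡⟨ map-concatMap (map f) (insertions x) (permutations xs) ⟩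
  concatMap (map (map f) ∘ insertions x) (permutations xs)      ≡⟨ concatMap-cong (map-insertions f x) (permutations xs) ⟩
  concatMap (insertions (f x) ∘ map f) (permutations xs)        ≡⟨ concatMap-map (insertions (f x)) (map f) (permutations xs) ⟨
  concatMap (insertions (f x)) (map (map f) (permutations xs)) ≡⟨ cong (concatMap (insertions (f x))) (map-permutations f xs) ⟩
  concatMap (insertions (f x)) (permutations (map f xs))       ∎
  where open ≡-Reasoning

concatMap-insertions-∷ : ∀ x a rs → concatMap (insertions x) (map (a ∷_) rs) ↭
                         map (x ∷_) (map (a ∷_) rs) ++ map (a ∷_) (concatMap (insertions x) rs)
concatMap-insertions-∷ x a rs = begin
  concatMap (insertions x) (map (a ∷_) rs)                    ≡⟨ concatMap-map (insertions x) (a ∷_) rs ⟩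
  concatMap (λ r → (x ∷ a ∷ r) ∷ map (a ∷_) (insertions x r)) rs ↭⟨ concatMap-∷ (λ r → x ∷ a ∷ r) (map (a ∷_) ∘ insertions x) rs ⟩
  map (λ r → x ∷ a ∷ r) rs ++ concatMap (map (a ∷_) ∘ insertions x) rs
    ≡⟨ cong₂ _++_ (map-∘ rs) (sym (map-concatMap (a ∷_) (insertions x) rs)) ⟩
  map (x ∷_) (map (a ∷_) rs) ++ map (a ∷_) (concatMap (insertions x) rs) ∎
  where open PermutationReasoning

insertions-comm : ∀ x y ps → concatMap (insertions x) (insertions y ps) ↭ concatMap (insertions y) (insertions x ps)
insertions-comm x y [] = ↭-swap _ _ ↭-refl
insertions-comm x y (a ∷ ps) = begin
  concatMap (insertions x) (insertions y (a ∷ ps))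
    ↭⟨ ↭-prep _ (↭-prep _ (++⁺ˡ xs (concatMap-insertions-∷ x a (insertions y ps)))) ⟩
  (x ∷ y ∷ a ∷ ps) ∷ (y ∷ x ∷ a ∷ ps) ∷ (xs ++ ys ++ map (a ∷_) (concatMap (insertions x) (insertions y ps)))
    ↭⟨ ↭-swap _ _ (shifts xs ys) ⟩
  (y ∷ x ∷ a ∷ ps) ∷ (x ∷ y ∷ a ∷ ps) ∷ (ys ++ xs ++ map (a ∷_) (concatMap (insertions x) (insertions y ps)))
    ↭⟨ ↭-prep _ (↭-prep _ (++⁺ˡ ys (++⁺ˡ xs (↭-map⁺ (a ∷_) (insertions-comm x y ps))))) ⟩
  (y ∷ x ∷ a ∷ ps) ∷ (x ∷ y ∷ a ∷ ps) ∷ (ys ++ xs ++ map (a ∷_) (concatMap (insertions y) (insertions x ps)))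
    ↭⟨ ↭-prep _ (↭-prep _ (++⁺ˡ ys (concatMap-insertions-∷ y a (insertions x ps)))) ⟨
  concatMap (insertions y) (insertions x (a ∷ ps)) ∎
  where
  open PermutationReasoning
  xs = map (y ∷_) (map (a ∷_) (insertions x ps))
  ys = map (x ∷_) (map (a ∷_) (insertions y ps))

permutations⁺ : ∀ {xs ys} → xs ↭ ys → permutations xs ↭ permutations ys
permutations⁺ ↭.refl = ↭-refl
permutations⁺ (↭.prep x p) = concatMap⁺ (insertions x) (permutations⁺ p)
permutations⁺ {_ ∷ _ ∷ xs} {_ ∷ _ ∷ ys} (↭.swap x y p) = begin
  concatMap (insertions x) (concatMap (insertions y) (permutations xs))
    ≡⟨ concatMap-concatMap (insertions x) (insertions y) (permutations xs) ⟩
  concatMap (concatMap (insertions x) ∘ insertions y) (permutations xs)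
    ↭⟨ concatMap-↭-pointwise (insertions-comm x y) (permutations xs) ⟩
  concatMap (concatMap (insertions y) ∘ insertions x) (permutations xs)
    ≡⟨ concatMap-concatMap (insertions y) (insertions x) (permutations xs) ⟨
  concatMap (insertions y) (concatMap (insertions x) (permutations xs))
    ↭⟨ concatMap⁺ (insertions y) (concatMap⁺ (insertions x) (permutations⁺ p)) ⟩
  concatMap (insertions y) (concatMap (insertions x) (permutations ys)) ∎
  where open PermutationReasoning
permutations⁺ (↭.trans p q) = ↭-trans (permutations⁺ p) (permutations⁺ q)

∈-oneTo⁻ : ∀ {n a} → a ∈ oneTo n → a ≤ n
∈-oneTo⁻ a∈ with i , i∈ , refl ← ∈-map⁻ suc a∈ = ∈-upTo⁻ i∈

∈-oneTo⁺ : ∀ {n a} → 0 < a → a ≤ n → a ∈ oneTo n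
∈-oneTo⁺ {a = suc a} _ a<n = ∈-map⁺ suc (∈-upTo⁺ a<n)

applyUpTo-∸-↭ : ∀ n → applyUpTo (n ∸_) n ↭ applyUpTo suc n
applyUpTo-∸-↭ zero = ↭-refl
applyUpTo-∸-↭ (suc n) = begin
  suc n ∷ applyUpTo (n ∸_) n    ↭⟨ ↭-prep (suc n) (applyUpTo-∸-↭ n) ⟩
  suc n ∷ applyUpTo suc n       ↭⟨ ∷↭∷ʳ (suc n) (applyUpTo suc n) ⟩
  applyUpTo suc n ++ suc n ∷ [] ≡⟨ applyUpTo-∷ʳ suc n ⟩
  applyUpTo suc (suc n)         ∎
  where open PermutationReasoning

complement-oneTo : ∀ n → map (suc n ∸_) (oneTo n) ↭ oneTo n
complement-oneTo n = begin
  map (suc n ∸_) (map suc (upTo n)) ≡⟨ map-∘ (upTo n) ⟨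
  map (n ∸_) (upTo n)               ≡⟨ map-upTo (n ∸_) n ⟩
  applyUpTo (n ∸_) n                ↭⟨ applyUpTo-∸-↭ n ⟩
  applyUpTo suc n                   ≡⟨ map-upTo suc n ⟨
  map suc (upTo n)                  ∎
  where open PermutationReasoning

∈-S⁻ : ∀ {n w} → w ∈ S n → w ↭ oneTo n
∈-S⁻ {n} = ∈-permutations⁻ (oneTo n)

length-S : ∀ n → length (S n) ≡ n !
length-S n = trans (length-permutations (oneTo n)) (cong _! (trans (length-map suc (upTo n)) (length-upTo n)))

map-complement-S : ∀ n → map (map (suc n ∸_)) (S n) ↭ S n
map-complement-S n = ↭-trans (↭-reflexive (map-permutations (suc n ∸_) (oneTo n))) (permutations⁺ (complement-oneTo n))

∈-subsequences⁺ : ∀ {s w} → s ⊆ w → s ∈ subsequences w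
∈-subsequences⁺ [] = here refl
∈-subsequences⁺ (_∷_ {x = x} refl s⊆w) = ∈-++⁺ˡ (∈-map⁺ (x ∷_) (∈-subsequences⁺ s⊆w))
∈-subsequences⁺ (_∷ʳ_ {ys = w} x s⊆w) = ∈-++⁺ʳ (map (x ∷_) (subsequences w)) (∈-subsequences⁺ s⊆w)

∈-subsequences⁻ : ∀ w {s} → s ∈ subsequences w → s ⊆ w
∈-subsequences⁻ [] (here refl) = []
∈-subsequences⁻ (x ∷ w) s∈ with ∈-++⁻ (map (x ∷_) (subsequences w)) s∈
... | inj₂ s∈′ = x ∷ʳ ∈-subsequences⁻ w s∈′
... | inj₁ xs∈ with ∈-map⁻ (x ∷_) xs∈
...   | s′ , s′∈ , refl = refl ∷ ∈-subsequences⁻ w s′∈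

module _ (p : List ℕ → Bool) where

  maxLen-upper : ∀ {s w} → s ⊆ w → T (p s) → length s ≤ maxLen p w
  maxLen-upper {s} s⊆w ps with p s | ∈⇒≤maximum (∈-map⁺ (λ s → if p s then length s else 0) (∈-subsequences⁺ s⊆w))
  ... | true | ≤maxLen = ≤maxLen

  maxLen-lub : ∀ w {N} → (∀ {s} → s ⊆ w → T (p s) → length s ≤ N) → maxLen p w ≤ N
  maxLen-lub w {N} bound = maximum-lub (All.map⁺ (All.tabulate (λ s∈ → value≤N (∈-subsequences⁻ w s∈))))
    where
    value≤N : ∀ {s} → s ⊆ w → (if p s then length s else 0) ≤ N
    value≤N {s} s⊆w with p s in ps
    ... | true = bound s⊆w (Equivalence.from T-≡ ps)
    ... | false = z≤n

  maxLen-lub-suc : ∀ w {N} → 1 ≤ N → (∀ {s} → s ⊆ w → T (p s) → suc (length s) ≤ N) → suc (maxLen p w) ≤ N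
  maxLen-lub-suc w {suc N} _ bound = s≤s (maxLen-lub w (λ s⊆w ps → s≤s⁻¹ (bound s⊆w ps)))

  maxLen-mono : ∀ {w w′} → w ⊆ w′ → maxLen p w ≤ maxLen p w′
  maxLen-mono w⊆w′ = maxLen-lub _ (λ s⊆w ps → maxLen-upper (⊆-trans s⊆w w⊆w′) ps)

maxLen-∨ : ∀ (p q : List ℕ → Bool) w → maxLen (λ s → p s ∨ q s) w ≡ maxLen p w ⊔ maxLen q w
maxLen-∨ p q w = ≤-antisym (maxLen-lub p∨q w (λ s⊆w → [ viaˡ s⊆w , viaʳ s⊆w ] ∘ Equivalence.to T-∨))
  (⊔-lub (maxLen-lub p w (λ s⊆w → maxLen-upper p∨q s⊆w ∘ Equivalence.from T-∨ ∘ inj₁))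
         (maxLen-lub q w (λ s⊆w → maxLen-upper p∨q s⊆w ∘ Equivalence.from T-∨ ∘ inj₂)))
  where
  p∨q : List ℕ → Bool
  p∨q s = p s ∨ q s
  viaˡ : ∀ {s} → s ⊆ w → T (p s) → length s ≤ maxLen p w ⊔ maxLen q w
  viaˡ s⊆w ps = ≤-trans (maxLen-upper p s⊆w ps) (m≤m⊔n _ _)
  viaʳ : ∀ {s} → s ⊆ w → T (q s) → length s ≤ maxLen p w ⊔ maxLen q w
  viaʳ s⊆w qs = ≤-trans (maxLen-upper q s⊆w qs) (m≤n⊔m _ _)

module Alternation (k : ℕ) where

  alt : Bool → List ℕ → Bool
  alt true = kAlt k
  alt false = kRevAlt k

  KStep : Bool → ℕ → ℕ → Set
  KStep true a b = b < a × k + b ≤ a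
  KStep false a b = a < b × k + a ≤ b

  -- a′ may replace a as the first entry of a sequence whose first step is in direction d.
  Better : Bool → ℕ → ℕ → Set
  Better true a a′ = a ≤ a′
  Better false a a′ = a′ ≤ a

  alt-[] : ∀ d → T (alt d [])
  alt-[] true = _
  alt-[] false = _

  alt-singleton : ∀ d x → T (alt d (x ∷ []))
  alt-singleton true x = _
  alt-singleton false x = _

  farApart⇒down : ∀ {a b} → b < a → T (farApart k a b) → k + b ≤ a
  farApart⇒down {a} {b} b<a far with Equivalence.to T-∨ far
  ... | inj₁ k+b≤a = ≤ᵇ⇒≤ _ _ k+b≤a
  ... | inj₂ k+a≤b = ⊥-elim (<⇒≱ b<a (≤-trans (m≤n+m a k) (≤ᵇ⇒≤ _ _ k+a≤b)))

  farApart⇒up : ∀ {a b} → a < b → T (farApart k a b) → k + a ≤ b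
  farApart⇒up {a} {b} a<b far with Equivalence.to T-∨ far
  ... | inj₁ k+b≤a = ⊥-elim (<⇒≱ a<b (≤-trans (m≤n+m b k) (≤ᵇ⇒≤ _ _ k+b≤a)))
  ... | inj₂ k+a≤b = ≤ᵇ⇒≤ _ _ k+a≤b

  alt-∷∷⁻ : ∀ d {a b r} → T (alt d (a ∷ b ∷ r)) → KStep d a b × T (alt (not d) (b ∷ r))
  alt-∷∷⁻ true alt-abr with Equivalence.to T-∧ alt-abr
  ... | b<a , rest with Equivalence.to T-∧ rest
  ...   | far , alt-br = (<ᵇ⇒< _ _ b<a , farApart⇒down (<ᵇ⇒< _ _ b<a) far) , alt-br
  alt-∷∷⁻ false alt-abr with Equivalence.to T-∧ alt-abr
  ... | a<b , rest with Equivalence.to T-∧ rest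
  ...   | far , alt-br = (<ᵇ⇒< _ _ a<b , farApart⇒up (<ᵇ⇒< _ _ a<b) far) , alt-br

  alt-∷∷⁺ : ∀ d {a b r} → KStep d a b → T (alt (not d) (b ∷ r)) → T (alt d (a ∷ b ∷ r))
  alt-∷∷⁺ true (b<a , k+b≤a) alt-br =
    Equivalence.from T-∧ (<⇒<ᵇ b<a , Equivalence.from T-∧ (Equivalence.from T-∨ (inj₁ (≤⇒≤ᵇ k+b≤a)) , alt-br))
  alt-∷∷⁺ false (a<b , k+a≤b) alt-br =
    Equivalence.from T-∧ (<⇒<ᵇ a<b , Equivalence.from T-∧ (Equivalence.from T-∨ (inj₂ (≤⇒≤ᵇ k+a≤b)) , alt-br))

  alt-tail : ∀ d {b r} → T (alt d (b ∷ r)) → T (alt (not d) r)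
  alt-tail d {r = []} _ = alt-[] (not d)
  alt-tail d {r = c ∷ r} alt-br = proj₂ (alt-∷∷⁻ d alt-br)

  KStep-improveˡ : ∀ d {a a′ b} → KStep d a b → Better d a a′ → KStep d a′ b
  KStep-improveˡ true (b<a , k+b≤a) a≤a′ = <-≤-trans b<a a≤a′ , ≤-trans k+b≤a a≤a′
  KStep-improveˡ false (a<b , k+a≤b) a′≤a = ≤-<-trans a′≤a a<b , ≤-trans (+-monoʳ-≤ k a′≤a) k+a≤b

  KStep-improveʳ : ∀ d {a b b′} → KStep d a b → Better d b′ b → KStep d a b′
  KStep-improveʳ true (b<a , k+b≤a) b′≤b = ≤-<-trans b′≤b b<a , ≤-trans (+-monoʳ-≤ k b′≤b) k+b≤a
  KStep-improveʳ false (a<b , k+a≤b) b≤b′ = <-≤-trans a<b b≤b′ , ≤-trans k+a≤b b≤b′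

  alt-improve-head : ∀ d {a a′ r} → T (alt d (a ∷ r)) → Better d a a′ → T (alt d (a′ ∷ r))
  alt-improve-head d {r = []} _ _ = alt-singleton d _
  alt-improve-head d {r = b ∷ r} alt-abr better =
    let step , alt-br = alt-∷∷⁻ d alt-abr in alt-∷∷⁺ d (KStep-improveˡ d step better) alt-br

  Better-dichotomy : ∀ d a b → Better (not d) a b ⊎ Better d a b
  Better-dichotomy true a b = ≤-total b a
  Better-dichotomy false a b = ⊎-swap (≤-total b a)

  altLen : Bool → List ℕ → ℕ
  altLen d = maxLen (alt d)

  altLen-∷-positive : ∀ d x w → 1 ≤ altLen d (x ∷ w)
  altLen-∷-positive d x w = maxLen-upper (alt d) (refl ∷ minimum w) (alt-singleton d x)

  altLen-step : ∀ d {x y ys} → KStep d x y → altLen d (x ∷ y ∷ ys) ≡ suc (altLen (not d) (y ∷ ys))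
  altLen-step d {x} {y} {ys} step = ≤-antisym
    (maxLen-lub (alt d) (x ∷ y ∷ ys) drop-head)
    (maxLen-lub-suc (alt (not d)) (y ∷ ys) (altLen-∷-positive d x (y ∷ ys)) prepend)
    where
    drop-head : ∀ {s} → s ⊆ x ∷ y ∷ ys → T (alt d s) → length s ≤ suc (altLen (not d) (y ∷ ys))
    drop-head {[]} _ _ = z≤n
    drop-head {_ ∷ _} (refl ∷ r⊆) alt-s = s≤s (maxLen-upper _ r⊆ (alt-tail d alt-s))
    drop-head {_ ∷ _} (_ ∷ʳ br⊆) alt-s = s≤s (maxLen-upper _ (∷ˡ⁻ br⊆) (alt-tail d alt-s))
    prepend : ∀ {s} → s ⊆ y ∷ ys → T (alt (not d) s) → suc (length s) ≤ altLen d (x ∷ y ∷ ys)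
    prepend {[]} _ _ = altLen-∷-positive d x (y ∷ ys)
    prepend (refl ∷ r⊆) alt-s = maxLen-upper _ (refl ∷ refl ∷ r⊆) (alt-∷∷⁺ d step alt-s)
    prepend {a ∷ r} (_ ∷ʳ ar⊆) alt-s with Better-dichotomy d a y
    ... | inj₁ y-better = maxLen-upper _ (refl ∷ refl ∷ ∷ˡ⁻ ar⊆)
                            (alt-∷∷⁺ d step (alt-improve-head (not d) alt-s y-better))
    ... | inj₂ a-better = maxLen-upper _ (refl ∷ y ∷ʳ ar⊆) (alt-∷∷⁺ d (KStep-improveʳ d step a-better) alt-s)

  altLen-skip-head : ∀ d {x y ys} → ¬ KStep d x y → Better d x y → altLen d (x ∷ y ∷ ys) ≡ altLen d (y ∷ ys)
  altLen-skip-head d {x} {y} {ys} no-step y-better =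
    ≤-antisym (maxLen-lub (alt d) (x ∷ y ∷ ys) bound) (maxLen-mono (alt d) {y ∷ ys} (x ∷ʳ ⊆-refl))
    where
    bound : ∀ {s} → s ⊆ x ∷ y ∷ ys → T (alt d s) → length s ≤ altLen d (y ∷ ys)
    bound (_ ∷ʳ s⊆) alt-s = maxLen-upper _ s⊆ alt-s
    bound (refl ∷ refl ∷ _) alt-s = ⊥-elim (no-step (proj₁ (alt-∷∷⁻ d alt-s)))
    bound (refl ∷ _ ∷ʳ r⊆) alt-s = maxLen-upper _ (refl ∷ r⊆) (alt-improve-head d alt-s y-better)

  altLen-skip-second : ∀ d {x y ys} → ¬ KStep d x y → Better d y x → altLen d (x ∷ y ∷ ys) ≡ altLen d (x ∷ ys)
  altLen-skip-second d {x} {y} {ys} no-step x-better =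
    ≤-antisym (maxLen-lub (alt d) (x ∷ y ∷ ys) bound) (maxLen-mono (alt d) {x ∷ ys} (refl ∷ y ∷ʳ ⊆-refl))
    where
    bound : ∀ {s} → s ⊆ x ∷ y ∷ ys → T (alt d s) → length s ≤ altLen d (x ∷ ys)
    bound (refl ∷ refl ∷ _) alt-s = ⊥-elim (no-step (proj₁ (alt-∷∷⁻ d alt-s)))
    bound (refl ∷ _ ∷ʳ r⊆) alt-s = maxLen-upper _ (refl ∷ r⊆) alt-s
    bound (_ ∷ʳ refl ∷ r⊆) alt-s = maxLen-upper _ (refl ∷ r⊆) (alt-improve-head d alt-s x-better)
    bound (_ ∷ʳ _ ∷ʳ s⊆) alt-s = maxLen-upper _ (x ∷ʳ s⊆) alt-s

  bestStart : Bool → ℕ → ℕ → ℕ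
  bestStart true = _⊔_
  bestStart false = _⊓_

  altLen-no-step : ∀ d {x y ys} → ¬ KStep d x y → altLen d (x ∷ y ∷ ys) ≡ altLen d (bestStart d x y ∷ ys)
  altLen-no-step true {x} {y} {ys} no-step with ≤-total x y
  ... | inj₁ x≤y = trans (altLen-skip-head true {ys = ys} no-step x≤y)
                         (cong (λ h → altLen true (h ∷ ys)) (sym (m≤n⇒m⊔n≡n x≤y)))
  ... | inj₂ y≤x = trans (altLen-skip-second true {ys = ys} no-step y≤x)
                         (cong (λ h → altLen true (h ∷ ys)) (sym (m≥n⇒m⊔n≡m y≤x)))
  altLen-no-step false {x} {y} {ys} no-step with ≤-total x y
  ... | inj₁ x≤y = trans (altLen-skip-second false {ys = ys} no-step x≤y)
                         (cong (λ h → altLen false (h ∷ ys)) (sym (m≤n⇒m⊓n≡m x≤y)))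
  ... | inj₂ y≤x = trans (altLen-skip-head false {ys = ys} no-step y≤x)
                         (cong (λ h → altLen false (h ∷ ys)) (sym (m≥n⇒m⊓n≡n y≤x)))

  window⇒positive : ∀ {m M} → m ≤ M → M < k + m → 0 < k
  window⇒positive {m} m≤M M<k+m = +-cancelʳ-< m 0 k (≤-<-trans m≤M M<k+m)

  -- Invariant: m and M are the least and greatest entries of a prefix containing no k-step,
  -- which altLen-no-step has merged into the heads of m ∷ xs and M ∷ xs.
  altLen-window-adjacent : ∀ M m xs → m ≤ M → M < k + m → k + foldl _⊓_ m xs ≤ foldl _⊔_ M xs →
                           Adjacent (altLen true (M ∷ xs)) (altLen false (m ∷ xs))
  altLen-window-adjacent M m [] m≤M M<k+m k+m≤M = ⊥-elim (<⇒≱ M<k+m k+m≤M)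
  altLen-window-adjacent M m (z ∷ zs) m≤M M<k+m spread with k + z ≤? M | k + m ≤? z
  ... | yes k+z≤M | _ = inj₁ (trans (altLen-step true {ys = zs} (z<M , k+z≤M)) (cong suc (sym
                          (altLen-skip-head false {ys = zs} (λ step → <-asym z<m (proj₁ step)) (<⇒≤ z<m)))))
    where
    z<M : z < M
    z<M = <-≤-trans (m<n+m z (window⇒positive m≤M M<k+m)) k+z≤M
    z<m : z < m
    z<m = +-cancelˡ-< k z m (≤-<-trans k+z≤M M<k+m)
  ... | no _ | yes k+m≤z = inj₂ (trans (altLen-step false {ys = zs} (m<z , k+m≤z)) (cong suc (sym
                             (altLen-skip-head true {ys = zs} (λ step → <-asym M<z (proj₁ step)) (<⇒≤ M<z)))))
    where
    m<z : m < z
    m<z = <-≤-trans (m<n+m m (window⇒positive m≤M M<k+m)) k+m≤z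
    M<z : M < z
    M<z = <-≤-trans M<k+m k+m≤z
  ... | no k+z≰M | no k+m≰z = subst₂ Adjacent
    (sym (altLen-no-step true {ys = zs} (k+z≰M ∘ proj₂))) (sym (altLen-no-step false {ys = zs} (k+m≰z ∘ proj₂)))
    (altLen-window-adjacent (M ⊔ z) (m ⊓ z) zs (≤-trans (m⊓n≤m m z) (≤-trans m≤M (m≤m⊔n M z))) window spread)
    where
    window : M ⊔ z < k + (m ⊓ z)
    window = subst (M ⊔ z <_) (sym (+-distribˡ-⊓ k m z))
      (⊔-pres-<m (⊓-pres-m< M<k+m (≰⇒> k+z≰M)) (⊓-pres-m< (≰⇒> k+m≰z) (m<n+m z (window⇒positive m≤M M<k+m))))

  altLen-adjacent : ∀ {a b w} → 0 < k → a ∈ w → b ∈ w → k + a ≤ b → Adjacent (altLen true w) (altLen false w)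
  altLen-adjacent {a} {b} {x ∷ xs} 0<k a∈w b∈w k+a≤b = altLen-window-adjacent x x xs ≤-refl (m<n+m x 0<k)
    (≤-trans (+-monoʳ-≤ k (foldl-⊓-lower x xs a∈w)) (≤-trans k+a≤b (foldl-⊔-upper x xs b∈w)))

  farApart-complement : ∀ N {x y} → x ≤ N → y ≤ N → farApart k (N ∸ x) (N ∸ y) ≡ farApart k x y
  farApart-complement N {x} {y} x≤N y≤N =
    trans (cong₂ _∨_ (complement-≤ᵇ N k x≤N y≤N) (complement-≤ᵇ N k y≤N x≤N)) (∨-comm (k + x ≤ᵇ y) (k + y ≤ᵇ x))

  alt-complement : ∀ N d {s} → All (_≤ N) s → alt d (map (N ∸_) s) ≡ alt (not d) s
  alt-complement N true [] = refl
  alt-complement N false [] = refl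
  alt-complement N true (_ ∷ []) = refl
  alt-complement N false (_ ∷ []) = refl
  alt-complement N true (x≤N ∷ y≤N ∷ r≤N) = cong₂ _∧_ (complement-≤ᵇ N 1 x≤N y≤N)
    (cong₂ _∧_ (farApart-complement N x≤N y≤N) (alt-complement N false (y≤N ∷ r≤N)))
  alt-complement N false (x≤N ∷ y≤N ∷ r≤N) = cong₂ _∧_ (complement-≤ᵇ N 1 y≤N x≤N)
    (cong₂ _∧_ (farApart-complement N x≤N y≤N) (alt-complement N true (y≤N ∷ r≤N)))

  altLen-complement-≥ : ∀ N d {w} → All (_≤ N) w → altLen (not d) w ≤ altLen d (map (N ∸_) w)
  altLen-complement-≥ N d {w} w≤N = maxLen-lub (alt (not d)) w λ {s} s⊆w alt-s →
    subst (_≤ altLen d (map (N ∸_) w)) (length-map (N ∸_) s)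
      (maxLen-upper (alt d) (⊆-map⁺ (N ∸_) s⊆w)
        (subst T (sym (alt-complement N d (All-resp-⊆ s⊆w w≤N))) alt-s))

  altLen-complement : ∀ N d {w} → All (_≤ N) w → altLen d (map (N ∸_) w) ≡ altLen (not d) w
  altLen-complement N d {w} w≤N = ≤-antisym upper (altLen-complement-≥ N d w≤N)
    where
    open ≤-Reasoning
    upper : altLen d (map (N ∸_) w) ≤ altLen (not d) w
    upper = begin
      altLen d (map (N ∸_) w)                   ≡⟨ cong (λ e → altLen e (map (N ∸_) w)) (not-involutive d) ⟨
      altLen (not (not d)) (map (N ∸_) w)       ≤⟨ altLen-complement-≥ N (not d) (All.map⁺ (All.map (λ {x} _ → m∸n≤m N x) w≤N)) ⟩
      altLen (not d) (map (N ∸_) (map (N ∸_) w)) ≡⟨ cong (altLen (not d)) (complement-involutive N w≤N) ⟩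
      altLen (not d) w                          ∎

open Alternation

sum-altLen-false-S : ∀ k n → sum (map (altLen k false) (S n)) ≡ sum (map (as k) (S n))
sum-altLen-false-S k n = begin
  sum (map (altLen k false) (S n))           ≡⟨ cong sum (map-cong-local (All.tabulate complement)) ⟩
  sum (map (as k ∘ map c) (S n))             ≡⟨ cong sum (map-∘ (S n)) ⟩
  sum (map (as k) (map (map c) (S n)))       ≡⟨ sum-↭ (↭-map⁺ (as k) (map-complement-S n)) ⟩
  sum (map (as k) (S n))                     ∎
  where
  open ≡-Reasoning
  c : ℕ → ℕ
  c = suc n ∸_
  complement : ∀ {w} → w ∈ S n → altLen k false w ≡ as k (map c w)
  complement w∈S = sym (altLen-complement k (suc n) true
    (All.tabulate (λ a∈w → m≤n⇒m≤1+n (∈-oneTo⁻ (∈-resp-↭ (∈-S⁻ w∈S) a∈w)))))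

zs-double-S : ∀ k n → 0 < k → k + 1 ≤ n → ∀ {w} → w ∈ S n → zs k w + zs k w ≡ suc (as k w + altLen k false w)
zs-double-S k n 0<k k+1≤n {w} w∈S =
  trans (cong (λ v → v + v) (maxLen-∨ (kAlt k) (kRevAlt k) w)) (Adjacent⇒⊔+⊔ (altLen-adjacent k 0<k 1∈w n∈w k+1≤n))
  where
  1≤n : 1 ≤ n
  1≤n = ≤-trans (m≤n+m 1 k) k+1≤n
  1∈w : 1 ∈ w
  1∈w = ∈-resp-↭ (↭-sym (∈-S⁻ w∈S)) (∈-oneTo⁺ z<s 1≤n)
  n∈w : n ∈ w
  n∈w = ∈-resp-↭ (↭-sym (∈-S⁻ w∈S)) (∈-oneTo⁺ 1≤n ≤-refl)

sum-zs-double-S : ∀ k n → 0 < k → k + 1 ≤ n →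
  sum (map (zs k) (S n)) + sum (map (zs k) (S n)) ≡ n ! + (sum (map (as k) (S n)) + sum (map (as k) (S n)))
sum-zs-double-S k n 0<k k+1≤n = begin
  sum (map (zs k) (S n)) + sum (map (zs k) (S n))
    ≡⟨ sum-map-+ (zs k) (zs k) (S n) ⟨
  sum (map (λ w → zs k w + zs k w) (S n))
    ≡⟨ cong sum (map-cong-local (All.tabulate (zs-double-S k n 0<k k+1≤n))) ⟩
  sum (map (λ w → suc (as k w + altLen k false w)) (S n))
    ≡⟨ sum-map-suc (λ w → as k w + altLen k false w) (S n) ⟩
  length (S n) + sum (map (λ w → as k w + altLen k false w) (S n))
    ≡⟨ cong₂ _+_ (length-S n) (sum-map-+ (as k) (altLen k false) (S n)) ⟩
  n ! + (sum (map (as k) (S n)) + sum (map (altLen k false) (S n)))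
    ≡⟨ cong (λ t → n ! + (sum (map (as k) (S n)) + t)) (sum-altLen-false-S k n) ⟩
  n ! + (sum (map (as k) (S n)) + sum (map (as k) (S n))) ∎
  where open ≡-Reasoning

/-≡⇔*≡* : ∀ a b c d .{{_ : NonZero c}} .{{_ : NonZero d}} → ((+ a) / c ≡ (+ b) / d) ⇔ (a * d ≡ b * c)
/-≡⇔*≡* a b (suc c) (suc d) = mk⇔ to from
  where
  to : (+ a) / suc c ≡ (+ b) / suc d → a * suc d ≡ b * suc c
  to eq with *≡* cross ← fromℚᵘ-injective {mkℚᵘ (+ a) c} {mkℚᵘ (+ b) d} eq =
    ℤ.+-injective (trans (ℤ.pos-* a (suc d)) (trans cross (sym (ℤ.pos-* b (suc c)))))
  from : a * suc d ≡ b * suc c → (+ a) / suc c ≡ (+ b) / suc d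
  from eq = fromℚᵘ-cong {mkℚᵘ (+ a) c} {mkℚᵘ (+ b) d}
    (*≡* (trans (sym (ℤ.pos-* a (suc d))) (trans (cong +_ eq) (ℤ.pos-* b (suc c)))))

-- z / F = s / F + 1/2, cross-multiplied.
half-shift : ∀ {z s F} m → z + z ≡ F + (s + s) → (s * 6 ≡ (4 * m + 5) * F ⇔ z * 3 ≡ (2 * m + 4) * F)
half-shift {z} {s} {F} m z+z≡F+2s = mk⇔
  (λ eq → *-cancelʳ-≡ (z * 3) ((2 * m + 4) * F) 2 (trans doubled (trans (cong (λ t → F * 3 + t) eq) (sym (expand m F)))))
  (λ eq → +-cancelˡ-≡ (F * 3) (s * 6) ((4 * m + 5) * F) (trans (sym doubled) (trans (cong (_* 2) eq) (expand m F))))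
  where
  regroup : ∀ z → z * 3 * 2 ≡ (z + z) * 3
  regroup = solve-∀
  distribute : ∀ F s → (F + (s + s)) * 3 ≡ F * 3 + s * 6
  distribute = solve-∀
  expand : ∀ m F → (2 * m + 4) * F * 2 ≡ F * 3 + (4 * m + 5) * F
  expand = solve-∀
  doubled : z * 3 * 2 ≡ F * 3 + s * 6
  doubled = trans (regroup z) (trans (cong (_* 3) z+z≡F+2s) (distribute F s))

lemma1p2 : (n k : ℕ) → 2 ≤ k + 1 → k + 1 ≤ n →
    (E n (as k) ≡ (+ (4 * (n ∸ k) + 5)) / 6) ⇔ (E n (zs k) ≡ (+ (2 * (n ∸ k) + 4)) / 3)
lemma1p2 n k 2≤k+1 k+1≤n = begin
  (E n (as k) ≡ (+ (4 * (n ∸ k) + 5)) / 6)      ≈⟨ /-≡⇔*≡* Σas (4 * (n ∸ k) + 5) (n !) 6 {{n !≢0}} ⟩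
  (Σas * 6 ≡ (4 * (n ∸ k) + 5) * n !)          ≈⟨ half-shift {Σzs} {Σas} (n ∸ k) (sum-zs-double-S k n 0<k k+1≤n) ⟩
  (Σzs * 3 ≡ (2 * (n ∸ k) + 4) * n !)          ≈⟨ /-≡⇔*≡* Σzs (2 * (n ∸ k) + 4) (n !) 3 {{n !≢0}} ⟨
  (E n (zs k) ≡ (+ (2 * (n ∸ k) + 4)) / 3)      ∎
  where
  open SetoidReasoning (⇔-setoid 0ℓ)
  Σas Σzs : ℕ
  Σas = sum (map (as k) (S n))
  Σzs = sum (map (zs k) (S n))
  0<k : 0 < k
  0<k = s≤s⁻¹ (subst (2 ≤_) (+-comm k 1) 2≤k+1)
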